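{- Let $n\ge 3$, let $1\le i_0<j_0\le n$ with $j_0\ge i_0+2$, let $\alpha=\varepsilon_{i_0}-\varepsilon_{j_0}$, $s=s_\alpha$, and let $w\in S_n$ satisfy $w(i_0)>w(j_0)$ and $w(j_0)<w(k)<w(i_0)$ for all $k$ with $i_0<k<j_0$; put $w'=ws$. With $\kappa'$, $\kappa$, bad roots and $\mathfrak{D}_\beta$ as in the context, let $\beta=\alpha_{lm}$ be a negative root. Then $\kappa'_\beta\le\kappa'_{\beta_1}+\kappa'_{\beta_2}$ for all $(\beta_1,\beta_2)\in\mathfrak{D}_\beta$. Moreover, if there exists $(\beta_1,\beta_2)\in\mathfrak{D}_\beta$ with $\kappa_\beta>\kappa_{\beta_1}+\kappa_{\beta_2}$, then $l>j_0$ and $m\le i_0$, and $\beta_1$ shares the row of $-\alpha$, $\beta_2$ is bad, and either $s(\beta_1)$ is a bad (negative) root or $\beta_1=-\alpha$.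
   Context: $S_n$ acts on $\mathbb{Z}^n$ by $w(\varepsilon_i)=\varepsilon_{w(i)}$. For $l\ne m$, $\alpha_{lm}=\varepsilon_l-\varepsilon_m$, positive ($>0$) if $l<m$, negative ($<0$) if $l>m$; $w(\alpha_{lm})=\alpha_{w(l)w(m)}$. $s=s_\alpha$ is the transposition $(i_0\,j_0)$, $s(\alpha_{lm})=\alpha_{s(l)s(m)}$. $\delta_P$ is $1$ if $P$ holds, else $0$. For a negative root $\beta=\alpha_{lm}$ ($l>m$): it shares the row of $\alpha$ if $l=i_0$, the column of $\alpha$ if $m=j_0$, the row of $-\alpha$ if $l=j_0$, the column of $-\alpha$ if $m=i_0$. $\beta$ is bad if it shares the row or column of $\alpha$ and $\delta_{w(\beta)<0}=\delta_{w'(\beta)<0}$. Define $\kappa'_\beta=\delta_{w(\beta)<0}$ if $l=i_0$ or $m\in\{i_0,j_0\}$, and $\kappa'_\beta=\delta_{w'(\beta)<0}$ otherwise; define $\kappa_\beta=\kappa'_\beta-1$ if $l=j_0$ and $\kappa_\beta=\kappa'_\beta$ otherwise. $\mathfrak{D}_\beta=\{(\alpha_{km},\alpha_{lk}):m<k<l\}$. -}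

module Defs where

open import Data.Nat using (ℕ; zero; suc)
open import Data.Integer using (ℤ; +_; _-_)
open import Data.Fin using (Fin; _<_)
open import Data.Fin.Properties using (_<?_; _≟_)
open import Data.Fin.Permutation using (Permutation′; _⟨$⟩ʳ_; transpose)
open import Data.Bool using (Bool; true; false; if_then_else_; _∨_)
open import Data.Product using (_×_)
open import Data.Sum using (_⊎_)
open import Relation.Nullary.Decidable using (isYes)
open import Relation.Binary.PropositionalEquality using (_≡_)

-- Indices are 0-based: Fin n = {0,…,n-1} stands for {1,…,n}.
-- A root α_{lm} (l ≢ m) is represented by the pair (l , m);
-- it is negative iff m < l.

sfun : ∀ {n} → Fin n → Fin n → Fin n → Fin n
sfun i₀ j₀ x = transpose i₀ j₀ ⟨$⟩ʳ x

w′fun : ∀ {n} → Permutation′ n → Fin n → Fin n → Fin n → Fin n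
w′fun w i₀ j₀ x = w ⟨$⟩ʳ sfun i₀ j₀ x

-- δ_{f(α_{lm}) < 0} for f acting on indices: f(α_{lm}) = α_{f(l) f(m)} is
-- negative iff f(m) < f(l)
δneg : ∀ {n} → (Fin n → Fin n) → Fin n → Fin n → ℕ
δneg f l m = if isYes (f m <? f l) then 1 else 0

κ′ : ∀ {n} → Permutation′ n → Fin n → Fin n → Fin n → Fin n → ℕ
κ′ w i₀ j₀ l m =
  if isYes (l ≟ i₀) ∨ isYes (m ≟ i₀) ∨ isYes (m ≟ j₀)
  then δneg (w ⟨$⟩ʳ_) l m
  else δneg (w′fun w i₀ j₀) l m

κ : ∀ {n} → Permutation′ n → Fin n → Fin n → Fin n → Fin n → ℤ
κ w i₀ j₀ l m =
  if isYes (l ≟ j₀) then + κ′ w i₀ j₀ l m - + 1 else + κ′ w i₀ j₀ l m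

Bad : ∀ {n} → Permutation′ n → Fin n → Fin n → Fin n → Fin n → Set
Bad w i₀ j₀ l m =
  (l ≡ i₀ ⊎ m ≡ j₀) × (δneg (w ⟨$⟩ʳ_) l m ≡ δneg (w′fun w i₀ j₀) l m)

{-# OPTIONS --safe #-}
module Submission where

-- Writing [x < y] for the indicator δ<, κ′_{lm} = [w m < w l] off row j₀, while on row j₀ the
-- reflection replaces l by i₀ (also for m = i₀, since w j₀ < w i₀). Hence every instance of the
-- first claim is a triangle inequality [x < y] ≤ [x < a] + [b < y] with b ≤ a, namely
-- b = w j₀ < a = w i₀ when k = j₀. The shift κ = κ′ − 1 on row j₀ cancels unless k = j₀, and
-- then a violation forces equality in that triangle inequality: w m ∉ [w j₀, w i₀) and
-- w l ∉ (w j₀, w i₀]. These are the two badness conditions, and since w maps the indices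
-- strictly between i₀ and j₀ into (w j₀, w i₀), the first one also rules out i₀ < m < j₀.

open import Defs
open import Data.Nat using (ℕ; _≤_; _<_; _+_; zero; suc; z≤n; s≤s)
open import Data.Nat.Properties as ℕ using (+-suc; +-identityʳ; <⇒≱; ≮⇒≥)
open import Data.Integer using (+_; _-_; -<-) renaming (_+_ to _+ℤ_; _<_ to _<ℤ_)
open import Data.Integer.Properties using (drop‿+<+)
open import Data.Fin using (Fin; toℕ) renaming (_<_ to _<F_; _≤_ to _≤F_)
open import Data.Fin.Properties using (_<?_; _≟_; <-trans; <-asym; <-irrefl; <⇒≢; ≤∧≢⇒<)
open import Data.Fin.Permutation using (Permutation′; _⟨$⟩ʳ_)
open import Data.Bool using (if_then_else_)
open import Data.Product using (_×_; _,_)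
open import Data.Sum using (_⊎_; inj₁; inj₂)
open import Data.Empty using (⊥-elim)
open import Relation.Nullary using (Dec; yes; no)
open import Relation.Nullary.Decidable using (isYes; dec-true; dec-false)
open import Relation.Binary.PropositionalEquality using (_≡_; _≢_; refl; sym; ≢-sym; subst; subst₂)

δ< : ∀ {n} → Fin n → Fin n → ℕ
δ< x y = if isYes (x <? y) then 1 else 0

module _ {n : ℕ} where

  δ<-cong : {x y u v : Fin n} → (x <F y → u <F v) → (u <F v → x <F y) → δ< x y ≡ δ< u v
  δ<-cong {x} {y} {u} {v} to from with x <? y | u <? v
  ... | yes _   | yes _   = refl
  ... | yes x<y | no u≮v  = ⊥-elim (u≮v (to x<y))
  ... | no x≮y  | yes u<v = ⊥-elim (x≮y (from u<v))
  ... | no _    | no _    = refl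

  δ<-positive : {x y : Fin n} → 1 ≤ δ< x y → x <F y
  δ<-positive {x} {y} pos with x <? y
  ... | yes x<y = x<y
  δ<-positive () | no _

  δ<≤1 : (x y : Fin n) → δ< x y ≤ 1
  δ<≤1 x y with x <? y
  ... | yes _ = s≤s z≤n
  ... | no _  = z≤n

  δ<-triangle : {a b : Fin n} → b ≤F a → (x y : Fin n) → δ< x y ≤ δ< x a + δ< b y
  δ<-triangle {a} {b} b≤a x y with x <? y | x <? a | b <? y
  ... | no _    | _       | _      = z≤n
  ... | yes _   | yes _   | _      = s≤s z≤n
  ... | yes _   | no _    | yes _  = s≤s z≤n
  ... | yes x<y | no x≮a  | no b≮y = ⊥-elim (b≮y (ℕ.≤-<-trans b≤a (ℕ.≤-<-trans (≮⇒≥ x≮a) x<y)))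

  δ<-triangle-tight : {a b x y : Fin n} → δ< x a + δ< b y ≤ δ< x y →
                      (x <F a → x <F b) × (b <F y → a <F y)
  δ<-triangle-tight {a} {b} {x} {y} tight with x <? a | b <? y
  ... | yes _   | yes _  = ⊥-elim (ℕ.<-irrefl refl (ℕ.≤-trans tight (δ<≤1 x y)))
  ... | yes _   | no b≮y = (λ _ → ℕ.<-≤-trans (δ<-positive tight) (≮⇒≥ b≮y)) , λ b<y → ⊥-elim (b≮y b<y)
  ... | no x≮a  | yes _  = (λ x<a → ⊥-elim (x≮a x<a)) , λ _ → ℕ.≤-<-trans (≮⇒≥ x≮a) (δ<-positive tight)
  ... | no x≮a  | no b≮y = (λ x<a → ⊥-elim (x≮a x<a)) , λ b<y → ⊥-elim (b≮y b<y)

[a-1]+b<c⇒a+b≤c : ∀ a b c → (+ a - + 1) +ℤ + b <ℤ + c → a + b ≤ c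
[a-1]+b<c⇒a+b≤c (suc a) b       c h = drop‿+<+ h
[a-1]+b<c⇒a+b≤c zero    (suc b) c h = drop‿+<+ h
[a-1]+b<c⇒a+b≤c zero    zero    c _ = z≤n

a+[b-1]<c-1⇒a+b<c : ∀ a b c → + a +ℤ (+ b - + 1) <ℤ + c - + 1 → a + b < c
a+[b-1]<c-1⇒a+b<c a       (suc b) (suc c) h =
  subst (_< suc c) (sym (+-suc a b)) (s≤s (drop‿+<+ h))
a+[b-1]<c-1⇒a+b<c a       (suc b) zero    ()
a+[b-1]<c-1⇒a+b<c (suc a) zero    (suc c) h =
  subst (_< suc c) (sym (+-identityʳ (suc a))) (s≤s (drop‿+<+ h))
a+[b-1]<c-1⇒a+b<c (suc a) zero    zero    ()
a+[b-1]<c-1⇒a+b<c zero    zero    (suc c) _ = s≤s z≤n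
a+[b-1]<c-1⇒a+b<c zero    zero    zero    (-<- ())

module _ {n : ℕ} {i j : Fin n} where

  sfun-matchˡ : sfun i j i ≡ j
  sfun-matchˡ rewrite dec-true (i ≟ i) refl = refl

  sfun-matchʳ : i ≢ j → sfun i j j ≡ i
  sfun-matchʳ i≢j rewrite dec-false (j ≟ i) (λ j≡i → i≢j (sym j≡i)) | dec-true (j ≟ j) refl = refl

  sfun-mismatch : {x : Fin n} → x ≢ i → x ≢ j → sfun i j x ≡ x
  sfun-mismatch {x} x≢i x≢j rewrite dec-false (x ≟ i) x≢i | dec-false (x ≟ j) x≢j = refl

module _ {n : ℕ} (w : Permutation′ n) (i₀ j₀ : Fin n) where

  κ′-off-j₀ : {l m : Fin n} → l ≢ j₀ → κ′ w i₀ j₀ l m ≡ δ< (w ⟨$⟩ʳ m) (w ⟨$⟩ʳ l)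
  κ′-off-j₀ {l} {m} l≢j₀ with l ≟ i₀ | m ≟ i₀
  ... | yes _ | _     = refl
  ... | no _  | yes _ = refl
  ... | no _  | no _ with m ≟ j₀ | l ≟ j₀
  ...   | yes _ | _        = refl
  ...   | no _  | yes l≡j₀ = ⊥-elim (l≢j₀ l≡j₀)
  ...   | no _  | no _     = refl

  κ′-at-j₀ : i₀ ≢ j₀ → w ⟨$⟩ʳ j₀ <F w ⟨$⟩ʳ i₀ →
             {m : Fin n} → m ≢ j₀ → κ′ w i₀ j₀ j₀ m ≡ δ< (w ⟨$⟩ʳ m) (w ⟨$⟩ʳ i₀)
  κ′-at-j₀ i₀≢j₀ wj₀<wi₀ {m} m≢j₀ with j₀ ≟ i₀ | m ≟ i₀
  ... | yes j₀≡i₀ | _        = ⊥-elim (i₀≢j₀ (sym j₀≡i₀))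
  ... | no _      | yes refl =
    δ<-cong (λ wi₀<wj₀ → ⊥-elim (<-asym wj₀<wi₀ wi₀<wj₀)) (λ wi₀<wi₀ → ⊥-elim (<-irrefl refl wi₀<wi₀))
  ... | no _      | no _ with m ≟ j₀ | j₀ ≟ j₀
  ...   | yes m≡j₀ | _         = ⊥-elim (m≢j₀ m≡j₀)
  ...   | no _     | no j₀≢j₀  = ⊥-elim (j₀≢j₀ refl)
  ...   | no _     | yes _     = refl

  κ-off-j₀ : {l m : Fin n} → l ≢ j₀ → κ w i₀ j₀ l m ≡ + κ′ w i₀ j₀ l m
  κ-off-j₀ {l} l≢j₀ with l ≟ j₀
  ... | yes l≡j₀ = ⊥-elim (l≢j₀ l≡j₀)
  ... | no _     = refl

  κ-at-j₀ : {m : Fin n} → κ w i₀ j₀ j₀ m ≡ + κ′ w i₀ j₀ j₀ m - + 1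
  κ-at-j₀ with j₀ ≟ j₀
  ... | yes _    = refl
  ... | no j₀≢j₀ = ⊥-elim (j₀≢j₀ refl)

module _ {n : ℕ} (w : Permutation′ n) {i₀ j₀ : Fin n}
         (i₀<j₀ : i₀ <F j₀) (wj₀<wi₀ : w ⟨$⟩ʳ j₀ <F w ⟨$⟩ʳ i₀) where

  private
    W : Fin n → Fin n
    W x = w ⟨$⟩ʳ x

    i₀≢j₀ : i₀ ≢ j₀
    i₀≢j₀ = <⇒≢ i₀<j₀

  κ′-triangle : {l m k : Fin n} → m <F k → k <F l →
                κ′ w i₀ j₀ l m ≤ κ′ w i₀ j₀ k m + κ′ w i₀ j₀ l k
  -- Deciding j₀ ≟ k rather than k ≟ j₀: the latter occurs inside κ′ and κ, and `with` would
  -- abstract over it, so the evaluation lemmas above would no longer apply.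
  κ′-triangle {l} {m} {k} m<k k<l with j₀ ≟ k | j₀ ≟ l
  ... | yes refl | _
    rewrite κ′-off-j₀ w i₀ j₀ {l} {m} (≢-sym (<⇒≢ k<l))
          | κ′-off-j₀ w i₀ j₀ {l} {j₀} (≢-sym (<⇒≢ k<l))
          | κ′-at-j₀ w i₀ j₀ i₀≢j₀ wj₀<wi₀ (<⇒≢ m<k)
    = δ<-triangle (ℕ.<⇒≤ wj₀<wi₀) (W m) (W l)
  ... | no j₀≢k | yes refl
    rewrite κ′-at-j₀ w i₀ j₀ i₀≢j₀ wj₀<wi₀ (<⇒≢ (<-trans m<k k<l))
          | κ′-at-j₀ w i₀ j₀ i₀≢j₀ wj₀<wi₀ (≢-sym j₀≢k) | κ′-off-j₀ w i₀ j₀ {k} {m} (≢-sym j₀≢k)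
    = δ<-triangle ℕ.≤-refl (W m) (W i₀)
  ... | no j₀≢k | no j₀≢l
    rewrite κ′-off-j₀ w i₀ j₀ {l} {m} (≢-sym j₀≢l) | κ′-off-j₀ w i₀ j₀ {k} {m} (≢-sym j₀≢k)
          | κ′-off-j₀ w i₀ j₀ {l} {k} (≢-sym j₀≢l)
    = δ<-triangle ℕ.≤-refl (W m) (W l)

  κ-violation⇒column-j₀ : {l m k : Fin n} → m <F k → k <F l →
                          κ w i₀ j₀ k m +ℤ κ w i₀ j₀ l k <ℤ κ w i₀ j₀ l m →
                          k ≡ j₀ × (W m <F W i₀ → W m <F W j₀) × (W j₀ <F W l → W i₀ <F W l)
  κ-violation⇒column-j₀ {l} {m} {k} m<k k<l violation with j₀ ≟ k | j₀ ≟ l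
  ... | yes refl | _
    rewrite κ-at-j₀ w i₀ j₀ {m}
          | κ-off-j₀ w i₀ j₀ {l} {j₀} (≢-sym (<⇒≢ k<l)) | κ-off-j₀ w i₀ j₀ {l} {m} (≢-sym (<⇒≢ k<l))
          | κ′-off-j₀ w i₀ j₀ {l} {m} (≢-sym (<⇒≢ k<l)) | κ′-off-j₀ w i₀ j₀ {l} {j₀} (≢-sym (<⇒≢ k<l))
          | κ′-at-j₀ w i₀ j₀ i₀≢j₀ wj₀<wi₀ (<⇒≢ m<k)
    = refl , δ<-triangle-tight
               ([a-1]+b<c⇒a+b≤c (δ< (W m) (W i₀)) (δ< (W j₀) (W l)) (δ< (W m) (W l)) violation)
  ... | no j₀≢k | yes refl
    rewrite κ-at-j₀ w i₀ j₀ {m} | κ-at-j₀ w i₀ j₀ {k} | κ-off-j₀ w i₀ j₀ {k} {m} (≢-sym j₀≢k)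
    = ⊥-elim (<⇒≱ (a+[b-1]<c-1⇒a+b<c (κ′ w i₀ j₀ k m) (κ′ w i₀ j₀ j₀ k) (κ′ w i₀ j₀ j₀ m) violation)
                  (κ′-triangle m<k k<l))
  ... | no j₀≢k | no j₀≢l
    rewrite κ-off-j₀ w i₀ j₀ {l} {m} (≢-sym j₀≢l) | κ-off-j₀ w i₀ j₀ {k} {m} (≢-sym j₀≢k)
          | κ-off-j₀ w i₀ j₀ {l} {k} (≢-sym j₀≢l)
    = ⊥-elim (<⇒≱ (drop‿+<+ violation) (κ′-triangle m<k k<l))

  bad-at-column-j₀ : {l : Fin n} → j₀ <F l → (W j₀ <F W l → W i₀ <F W l) → Bad w i₀ j₀ l j₀
  bad-at-column-j₀ {l} j₀<l Wj₀<Wl⇒Wi₀<Wl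
    rewrite sfun-matchʳ i₀≢j₀
          | sfun-mismatch {x = l} (≢-sym (<⇒≢ (<-trans i₀<j₀ j₀<l))) (≢-sym (<⇒≢ j₀<l))
    = inj₂ refl , δ<-cong Wj₀<Wl⇒Wi₀<Wl (<-trans wj₀<wi₀)

  bad-at-row-i₀ : {m : Fin n} → m <F i₀ → (W m <F W i₀ → W m <F W j₀) → Bad w i₀ j₀ i₀ m
  bad-at-row-i₀ {m} m<i₀ Wm<Wi₀⇒Wm<Wj₀
    rewrite sfun-matchˡ {i = i₀} {j = j₀}
          | sfun-mismatch {x = m} (<⇒≢ m<i₀) (<⇒≢ (<-trans m<i₀ i₀<j₀))
    = inj₁ refl , δ<-cong Wm<Wi₀⇒Wm<Wj₀ (λ Wm<Wj₀ → <-trans Wm<Wj₀ wj₀<wi₀)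

  reflected-root-bad : {m : Fin n} → m <F i₀ → (W m <F W i₀ → W m <F W j₀) →
                       sfun i₀ j₀ m <F sfun i₀ j₀ j₀ × Bad w i₀ j₀ (sfun i₀ j₀ j₀) (sfun i₀ j₀ m)
  reflected-root-bad {m} m<i₀ Wm<Wi₀⇒Wm<Wj₀ =
    subst₂ _<F_ (sym s[m]≡m) (sym s[j₀]≡i₀) m<i₀ ,
    subst₂ (Bad w i₀ j₀) (sym s[j₀]≡i₀) (sym s[m]≡m) (bad-at-row-i₀ m<i₀ Wm<Wi₀⇒Wm<Wj₀)
    where
    s[m]≡m : sfun i₀ j₀ m ≡ m
    s[m]≡m = sfun-mismatch (<⇒≢ m<i₀) (<⇒≢ (<-trans m<i₀ i₀<j₀))
    s[j₀]≡i₀ : sfun i₀ j₀ j₀ ≡ i₀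
    s[j₀]≡i₀ = sfun-matchʳ i₀≢j₀

  κ-violation⇒configuration :
    (∀ k → i₀ <F k → k <F j₀ → (W j₀ <F W k) × (W k <F W i₀)) →
    {l m k : Fin n} → m <F k → k <F l →
    κ w i₀ j₀ k m +ℤ κ w i₀ j₀ l k <ℤ κ w i₀ j₀ l m →
    (j₀ <F l) × (m ≤F i₀) × (k ≡ j₀) × Bad w i₀ j₀ l k ×
    ((sfun i₀ j₀ m <F sfun i₀ j₀ k × Bad w i₀ j₀ (sfun i₀ j₀ k) (sfun i₀ j₀ m)) ⊎ (k ≡ j₀ × m ≡ i₀))
  κ-violation⇒configuration between {l} {m} m<k k<l violation
    with κ-violation⇒column-j₀ m<k k<l violation
  ... | refl , Wm<Wi₀⇒Wm<Wj₀ , Wj₀<Wl⇒Wi₀<Wl =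
    k<l , m≤i₀ , refl , bad-at-column-j₀ k<l Wj₀<Wl⇒Wi₀<Wl , reflected-or-α (i₀ ≟ m)
    where
    m≤i₀ : m ≤F i₀
    m≤i₀ = ≮⇒≥ λ i₀<m → let Wj₀<Wm , Wm<Wi₀ = between m i₀<m m<k
                         in <-asym Wj₀<Wm (Wm<Wi₀⇒Wm<Wj₀ Wm<Wi₀)

    reflected-or-α : Dec (i₀ ≡ m) →
      (sfun i₀ j₀ m <F sfun i₀ j₀ j₀ × Bad w i₀ j₀ (sfun i₀ j₀ j₀) (sfun i₀ j₀ m)) ⊎ (j₀ ≡ j₀ × m ≡ i₀)
    reflected-or-α (yes i₀≡m) = inj₂ (refl , sym i₀≡m)
    reflected-or-α (no i₀≢m)  = inj₁ (reflected-root-bad (≤∧≢⇒< m≤i₀ (≢-sym i₀≢m)) Wm<Wi₀⇒Wm<Wj₀)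

lemma3p2p3 : (n : ℕ) → 3 ≤ n → (i₀ j₀ : Fin n) → i₀ <F j₀ → toℕ i₀ + 2 ≤ toℕ j₀ →
    (w : Permutation′ n) → w ⟨$⟩ʳ j₀ <F w ⟨$⟩ʳ i₀ →
    (∀ k → i₀ <F k → k <F j₀ → (w ⟨$⟩ʳ j₀ <F w ⟨$⟩ʳ k) × (w ⟨$⟩ʳ k <F w ⟨$⟩ʳ i₀)) →
    (l m : Fin n) → m <F l →
    (∀ k → m <F k → k <F l → κ′ w i₀ j₀ l m ≤ κ′ w i₀ j₀ k m + κ′ w i₀ j₀ l k) ×
    (∀ k → m <F k → k <F l →
      κ w i₀ j₀ k m +ℤ κ w i₀ j₀ l k <ℤ κ w i₀ j₀ l m →
      (j₀ <F l) × (m ≤F i₀) × (k ≡ j₀) × Bad w i₀ j₀ l k ×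
      ((sfun i₀ j₀ m <F sfun i₀ j₀ k × Bad w i₀ j₀ (sfun i₀ j₀ k) (sfun i₀ j₀ m))
        ⊎ (k ≡ j₀ × m ≡ i₀)))
lemma3p2p3 _ _ i₀ j₀ i₀<j₀ _ w wj₀<wi₀ between l m _ =
  (λ k → κ′-triangle w i₀<j₀ wj₀<wi₀) ,
  (λ k → κ-violation⇒configuration w i₀<j₀ wj₀<wi₀ between)
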